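{- For every spanoid $\mathcal S$ on $[n]$, $\mathrm{rank}(\mathcal S)\le\log_2|\mathcal C_{\mathcal S}|=\log_2|\mathcal O_{\mathcal S}|$, where $\mathcal C_{\mathcal S}$ and $\mathcal O_{\mathcal S}$ are the families of closed and open sets of $\mathcal S$.
   Context: A spanoid $\mathcal S$ on $[n]$ is a family of pairs $(S,i)$ with $S\subseteq[n]$, $i\in[n]$ (rules). For $T\subseteq[n]$, $i\in[n]$ write $T\models i$ if there is a sequence $T=T_0,\dots,T_r$ ($r\ge0$) with $i\in T_r$ such that for each $j\in[r]$, $T_j=T_{j-1}\cup\{i_j\}$ where some $S\subseteq T_{j-1}$ has $(S,i_j)\in\mathcal S$. $\mathrm{span}(T)=\{i:T\models i\}$; $\mathrm{rank}(\mathcal S)$ is the minimum size of $T$ with $\mathrm{span}(T)=[n]$. A set $B\subseteq[n]$ is closed if $\mathrm{span}(B)=B$, and open if its complement is closed. -}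

module Defs where

open import Data.Nat using (ℕ; _≤_)
open import Data.Fin using (Fin)
open import Data.Fin.Subset using (Subset; _∈_; _⊆_; _∪_; ⁅_⁆; ∁; ∣_∣)
open import Data.List using (List)
open import Data.Product using (_×_; _,_; ∃-syntax)
open import Function.Bundles using (_⇔_)
import Data.List.Membership.Propositional as LMem
open import Relation.Binary.PropositionalEquality using (_≡_)

-- A spanoid on [n] = Fin n: a (finite) family of rules (S , i).
Spanoid : ℕ → Set
Spanoid n = List (Subset n × Fin n)

-- T ⊨ i : there is a derivation sequence T = T₀ ⊆ T₁ ⊆ … ⊆ T_r with i ∈ T_r,
-- each step T_j = T_{j-1} ∪ {i_j} justified by a rule (S , i_j) with S ⊆ T_{j-1}.
data Derives {n : ℕ} (𝒮 : Spanoid n) : Subset n → Fin n → Set where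
  done : ∀ {T i} → i ∈ T → Derives 𝒮 T i
  step : ∀ {T i S j} → LMem._∈_ (S , j) 𝒮 → S ⊆ T →
         Derives 𝒮 (T ∪ ⁅ j ⁆) i → Derives 𝒮 T i

Spans : ∀ {n} → Spanoid n → Subset n → Set
Spans 𝒮 T = ∀ i → Derives 𝒮 T i

IsRank : ∀ {n} → Spanoid n → ℕ → Set
IsRank 𝒮 r = (∃[ T ] (Spans 𝒮 T × ∣ T ∣ ≡ r)) × (∀ T → Spans 𝒮 T → r ≤ ∣ T ∣)

Closed : ∀ {n} → Spanoid n → Subset n → Set
Closed 𝒮 B = ∀ i → (Derives 𝒮 B i ⇔ i ∈ B)

Open : ∀ {n} → Spanoid n → Subset n → Set
Open 𝒮 B = Closed 𝒮 (∁ B)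

module Submission where

-- Let T be a spanning set of minimum size, and write cl A for the closure of
-- A (the least closed superset of A, i.e. everything derivable from A).  For
-- A ⊆ T we have cl A ∩ T = A: if some x ∈ T ∖ A were derivable from A, then
-- T ⊆ cl (T - x), so the smaller set T - x would already span.  Hence
-- A ↦ cl A is injective on the 2^|T| subsets of T and lands in the closed
-- sets, giving 2^rank ≤ |𝒞|, i.e. rank ≤ ⌊log₂ |𝒞|⌋.  Complementation is an
-- involution exchanging closed and open sets, so |𝒞| = |𝒪|.

open import Defs
open import Data.Nat using (ℕ; _≤_)
open import Data.Nat.Logarithm using (⌊log₂_⌋)
open import Data.Fin.Subset using (Subset)
open import Data.List using (List; length)
open import Data.List.Membership.Propositional using (_∈_)
open import Data.List.Relation.Unary.Unique.Propositional using (Unique)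
open import Data.Product using (_×_)
open import Function.Bundles using (_⇔_)
open import Relation.Binary.PropositionalEquality using (_≡_)

open import Data.Nat using (zero; suc; _+_; _^_; _<_; s≤s; z≤n)
open import Data.Nat.Properties
  using (≤-trans; ≤-antisym; ≤-reflexive; +-suc; +-monoʳ-≤; +-identityʳ; m≤m+n; <⇒≱)
open import Data.Nat.Logarithm using (⌊log₂⌋-mono-≤; ⌊log₂[2^n]⌋≡n)
open import Data.Fin using (Fin)
open import Data.Fin.Properties using () renaming (_≟_ to _≟ᶠ_)
open import Data.Fin.Subset
  using (inside; outside; _⊆_; _∪_; ⁅_⁆; ∁; ∣_∣; _-_)
  renaming (_∈_ to _∈ˢ_; _∉_ to _∉ˢ_)
open import Data.Fin.Subset.Properties
  using ( _∈?_; _⊆?_; ⊆-antisym; p⊆p∪q; q⊆p∪q; x∈p∪q⁻; x∈⁅x⁆; x∈⁅y⁆⇒x≡y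
        ; p⊂q⇒∣p∣<∣q∣; ∣p∣≤n; ∣p∣≡n⇒p≡⊤; ∈⊤; x∈p⇒∣p-x∣<∣p∣; x∈p∧x≢y⇒x∈p-y
        ; out⊆; s⊆s; ∪-∩-booleanAlgebra)
import Algebra.Lattice.Properties.BooleanAlgebra as BooleanAlgebraProperties
open import Data.List using ([]; _∷_; map; _++_)
open import Data.List.Properties using (length-map; length-++; length-removeAt′)
open import Data.List.Relation.Unary.Any using (here; there; any?; _─_; index)
open import Data.List.Relation.Unary.All as All using ()
open import Data.List.Relation.Unary.AllPairs using ([]; _∷_)
import Data.List.Relation.Unary.Unique.Propositional.Properties as Unique
open import Data.List.Membership.Propositional using (find; lose)
open import Data.List.Membership.Propositional.Properties using (∈-map⁻; ∈-++⁻)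
open import Data.Vec using ([]; _∷_)
open import Data.Vec.Properties using (∷-injectiveʳ)
open import Data.Product using (∃; _,_)
open import Data.Sum using (_⊎_; inj₁; inj₂)
open import Data.Empty using (⊥-elim)
open import Relation.Nullary using (¬_; yes; no; contradiction)
open import Relation.Nullary.Decidable using (_×-dec_; ¬?; decidable-stable)
open import Function.Bundles using (mk⇔; Equivalence)
open import Relation.Binary.PropositionalEquality using (refl; sym; trans; cong; cong₂; subst)
open import Relation.Binary.PropositionalEquality.Properties using (module ≡-Reasoning)

∈-─ : ∀ {A : Set} {x y : A} {ys : List A} (x∈ys : x ∈ ys) → y ∈ ys → ¬ y ≡ x → y ∈ (ys ─ x∈ys)
∈-─ (here refl) (here refl) y≢x = ⊥-elim (y≢x refl)
∈-─ (here _)    (there y∈ys) _  = y∈ys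
∈-─ (there _)   (here y≡z)   _  = here y≡z
∈-─ (there x∈ys) (there y∈ys) y≢x = there (∈-─ x∈ys y∈ys y≢x)

module _ {A : Set} where

  injection⇒length≤ : ∀ {B : Set} (f : A → B) (xs : List A) (ys : List B) → Unique xs →
    (∀ {a b} → a ∈ xs → b ∈ xs → f a ≡ f b → a ≡ b) →
    (∀ {a} → a ∈ xs → f a ∈ ys) → length xs ≤ length ys
  injection⇒length≤ f []       ys _              _   _    = z≤n
  injection⇒length≤ f (x ∷ xs) ys (x∉xs ∷ uniq) inj into =
    subst (suc (length xs) ≤_) (sym (length-removeAt′ ys (index fx∈ys)))
      (s≤s (injection⇒length≤ f xs (ys ─ fx∈ys) uniq
              (λ a∈ b∈ → inj (there a∈) (there b∈)) into-rest))
    where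
    fx∈ys : f x ∈ ys
    fx∈ys = into (here refl)
    -- the images of xs avoid f x, since x occurs nowhere in xs
    into-rest : ∀ {a} → a ∈ xs → f a ∈ (ys ─ fx∈ys)
    into-rest a∈ = ∈-─ fx∈ys (into (there a∈))
      (λ fa≡fx → All.lookup x∉xs a∈ (sym (inj (there a∈) (here refl) fa≡fx)))

  involution⇒length≡ : (f : A → A) → (∀ a → f (f a) ≡ a) → (xs ys : List A) →
    Unique xs → Unique ys → (∀ {a} → a ∈ xs → f a ∈ ys) → (∀ {a} → a ∈ ys → f a ∈ xs) →
    length xs ≡ length ys
  involution⇒length≡ f invol xs ys uxs uys xs→ys ys→xs =
    ≤-antisym (injection⇒length≤ f xs ys uxs (λ _ _ → f-injective) xs→ys)
              (injection⇒length≤ f ys xs uys (λ _ _ → f-injective) ys→xs)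
    where
    f-injective : ∀ {a b} → f a ≡ f b → a ≡ b
    f-injective {a} {b} fa≡fb = trans (sym (invol a)) (trans (cong f fa≡fb) (invol b))

∁-involutive : ∀ {n} (B : Subset n) → ∁ (∁ B) ≡ B
∁-involutive {n} = BooleanAlgebraProperties.¬-involutive (∪-∩-booleanAlgebra n)

subsets : ∀ {n} → Subset n → List (Subset n)
subsets []            = [] ∷ []
subsets (outside ∷ T) = map (outside ∷_) (subsets T)
subsets (inside ∷ T)  = map (outside ∷_) (subsets T) ++ map (inside ∷_) (subsets T)

length-subsets : ∀ {n} (T : Subset n) → length (subsets T) ≡ 2 ^ ∣ T ∣
length-subsets [] = refl
length-subsets (outside ∷ T) = trans (length-map (outside ∷_) (subsets T)) (length-subsets T)
length-subsets (inside ∷ T) = begin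
  length (map (outside ∷_) (subsets T) ++ map (inside ∷_) (subsets T))
    ≡⟨ length-++ (map (outside ∷_) (subsets T)) ⟩
  length (map (outside ∷_) (subsets T)) + length (map (inside ∷_) (subsets T))
    ≡⟨ cong₂ _+_ (length-map (outside ∷_) (subsets T)) (length-map (inside ∷_) (subsets T)) ⟩
  length (subsets T) + length (subsets T)
    ≡⟨ cong₂ _+_ (length-subsets T) (trans (length-subsets T) (sym (+-identityʳ _))) ⟩
  2 ^ ∣ T ∣ + (2 ^ ∣ T ∣ + 0)
    ∎
  where open ≡-Reasoning

subsets-unique : ∀ {n} (T : Subset n) → Unique (subsets T)
subsets-unique [] = All.[] ∷ []
subsets-unique (outside ∷ T) = Unique.map⁺ ∷-injectiveʳ (subsets-unique T)
subsets-unique (inside ∷ T) =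
  Unique.++⁺ (Unique.map⁺ ∷-injectiveʳ (subsets-unique T))
             (Unique.map⁺ ∷-injectiveʳ (subsets-unique T)) heads-differ
  where
  heads-differ : ∀ {A} → ¬ (A ∈ map (outside ∷_) (subsets T) × A ∈ map (inside ∷_) (subsets T))
  heads-differ (A∈out , A∈in) with ∈-map⁻ (outside ∷_) A∈out | ∈-map⁻ (inside ∷_) A∈in
  ... | _ , _ , refl | _ , _ , ()

∈subsets⇒⊆ : ∀ {n} (T : Subset n) {A} → A ∈ subsets T → A ⊆ T
∈subsets⇒⊆ [] (here refl) ()
∈subsets⇒⊆ (outside ∷ T) A∈ with ∈-map⁻ (outside ∷_) A∈
... | _ , A′∈ , refl = out⊆ (∈subsets⇒⊆ T A′∈)
∈subsets⇒⊆ (inside ∷ T) A∈ with ∈-++⁻ (map (outside ∷_) (subsets T)) A∈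
... | inj₁ A∈out with ∈-map⁻ (outside ∷_) A∈out
...   | _ , A′∈ , refl = out⊆ (∈subsets⇒⊆ T A′∈)
∈subsets⇒⊆ (inside ∷ T) A∈ | inj₂ A∈in with ∈-map⁻ (inside ∷_) A∈in
...   | _ , A′∈ , refl = s⊆s (∈subsets⇒⊆ T A′∈)

∣∪⁅new⁆∣ : ∀ {n} {T : Subset n} {j : Fin n} → j ∉ˢ T → ∣ T ∣ < ∣ T ∪ ⁅ j ⁆ ∣
∣∪⁅new⁆∣ {T = T} {j} j∉T =
  p⊂q⇒∣p∣<∣q∣ (p⊆p∪q ⁅ j ⁆ , j , q⊆p∪q T ⁅ j ⁆ (x∈⁅x⁆ j) , j∉T)

module Closure {n : ℕ} (𝒮 : Spanoid n) where

  RuleClosed : Subset n → Set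
  RuleClosed U = ∀ {S j} → (S , j) ∈ 𝒮 → S ⊆ U → j ∈ˢ U

  derivable⇒∈ : ∀ {U T i} → RuleClosed U → T ⊆ U → Derives 𝒮 T i → i ∈ˢ U
  derivable⇒∈ closed T⊆U (done i∈T) = T⊆U i∈T
  derivable⇒∈ {U} {T} closed T⊆U (step {S = S} {j} rule S⊆T d) =
    derivable⇒∈ closed T∪j⊆U d
    where
    T∪j⊆U : T ∪ ⁅ j ⁆ ⊆ U
    T∪j⊆U x∈ with x∈p∪q⁻ T ⁅ j ⁆ x∈
    ... | inj₁ x∈T = T⊆U x∈T
    ... | inj₂ x∈j = subst (_∈ˢ U) (sym (x∈⁅y⁆⇒x≡y j x∈j)) (closed rule (λ s → T⊆U (S⊆T s)))

  Fires : Subset n → Subset n × Fin n → Set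
  Fires T (S , j) = S ⊆ T × j ∉ˢ T

  FiringRule : Subset n → Set
  FiringRule T = ∃ λ r → r ∈ 𝒮 × Fires T r

  fire-or-stop : ∀ T → FiringRule T ⊎ RuleClosed T
  fire-or-stop T with any? (λ { (S , j) → S ⊆? T ×-dec ¬? (j ∈? T) }) 𝒮
  ... | yes some = inj₁ (find some)
  ... | no none  = inj₂ λ {_} {j} rule S⊆T →
          decidable-stable (j ∈? T) (λ j∉T → none (lose rule (S⊆T , j∉T)))

  close : ℕ → Subset n → Subset n
  closeFrom : ℕ → (T : Subset n) → FiringRule T ⊎ RuleClosed T → Subset n
  close zero T = T
  close (suc k) T = closeFrom k T (fire-or-stop T)
  closeFrom k T (inj₁ ((_ , j) , _)) = close k (T ∪ ⁅ j ⁆)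
  closeFrom k T (inj₂ _) = T

  ⊆-close : ∀ k T → T ⊆ close k T
  ⊆-closeFrom : ∀ k T r → T ⊆ closeFrom k T r
  ⊆-close zero T x∈ = x∈
  ⊆-close (suc k) T = ⊆-closeFrom k T (fire-or-stop T)
  ⊆-closeFrom k T (inj₁ ((_ , j) , _)) x∈ = ⊆-close k (T ∪ ⁅ j ⁆) (p⊆p∪q ⁅ j ⁆ x∈)
  ⊆-closeFrom k T (inj₂ _) x∈ = x∈

  close-derivable : ∀ k T {i} → i ∈ˢ close k T → Derives 𝒮 T i
  closeFrom-derivable : ∀ k T r {i} → i ∈ˢ closeFrom k T r → Derives 𝒮 T i
  close-derivable zero T i∈ = done i∈
  close-derivable (suc k) T = closeFrom-derivable k T (fire-or-stop T)
  closeFrom-derivable k T (inj₁ ((_ , j) , rule , S⊆T , _)) i∈ =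
    step rule S⊆T (close-derivable k (T ∪ ⁅ j ⁆) i∈)
  closeFrom-derivable k T (inj₂ _) i∈ = done i∈

  full⇒RuleClosed : ∀ {T} → n ≤ ∣ T ∣ → RuleClosed T
  full⇒RuleClosed {T} n≤∣T∣ {j = j} _ _ =
    subst (j ∈ˢ_) (sym (∣p∣≡n⇒p≡⊤ (≤-antisym (∣p∣≤n T) n≤∣T∣))) ∈⊤

  -- Each firing grows the set, so with enough fuel the process stops at a
  -- rule-closed set.
  close-RuleClosed : ∀ k T → n ≤ k + ∣ T ∣ → RuleClosed (close k T)
  closeFrom-RuleClosed : ∀ k T r → n ≤ suc k + ∣ T ∣ → RuleClosed (closeFrom k T r)
  close-RuleClosed zero T fuel = full⇒RuleClosed fuel
  close-RuleClosed (suc k) T fuel = closeFrom-RuleClosed k T (fire-or-stop T) fuel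
  closeFrom-RuleClosed k T (inj₁ ((_ , j) , _ , _ , j∉T)) fuel =
    close-RuleClosed k (T ∪ ⁅ j ⁆)
      (≤-trans fuel (≤-trans (≤-reflexive (sym (+-suc k ∣ T ∣))) (+-monoʳ-≤ k (∣∪⁅new⁆∣ j∉T))))
  closeFrom-RuleClosed k T (inj₂ stop) _ = stop

  -- The closure: n firings always suffice.
  cl : Subset n → Subset n
  cl T = close n T

  ⊆-cl : ∀ T → T ⊆ cl T
  ⊆-cl = ⊆-close n

  cl-RuleClosed : ∀ T → RuleClosed (cl T)
  cl-RuleClosed T = close-RuleClosed n T (m≤m+n n ∣ T ∣)

  cl-closed : ∀ T → Closed 𝒮 (cl T)
  cl-closed T i = mk⇔ (derivable⇒∈ (cl-RuleClosed T) (λ i∈ → i∈)) done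

  cl-least : ∀ {A U} → RuleClosed U → A ⊆ U → cl A ⊆ U
  cl-least closed A⊆U i∈ = derivable⇒∈ closed A⊆U (close-derivable n _ i∈)

  spans-via-cl : ∀ {T U} → Spans 𝒮 T → T ⊆ cl U → Spans 𝒮 U
  spans-via-cl {T} {U} spans T⊆clU i =
    close-derivable n U (derivable⇒∈ (cl-RuleClosed U) T⊆clU (spans i))

module MinimumSpanning {n : ℕ} (𝒮 : Spanoid n) (T : Subset n) (spans : Spans 𝒮 T)
                       (minimum : ∀ T′ → Spans 𝒮 T′ → ∣ T ∣ ≤ ∣ T′ ∣) where
  open Closure 𝒮

  -- For A ⊆ T, cl A ∩ T = A: an extra x ∈ T derivable from A would make the
  -- smaller set T - x spanning.
  cl-trace : ∀ {A x} → A ⊆ T → x ∈ˢ T → x ∈ˢ cl A → x ∈ˢ A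
  cl-trace {A} {x} A⊆T x∈T x∈clA with x ∈? A
  ... | yes x∈A = x∈A
  ... | no x∉A  = contradiction (minimum (T - x) (spans-via-cl spans T⊆cl[T-x]))
                                (<⇒≱ (x∈p⇒∣p-x∣<∣p∣ x∈T))
    where
    A⊆T-x : A ⊆ T - x
    A⊆T-x {y} y∈A = x∈p∧x≢y⇒x∈p-y (A⊆T y∈A) (λ y≡x → x∉A (subst (_∈ˢ A) y≡x y∈A))
    T⊆cl[T-x] : T ⊆ cl (T - x)
    T⊆cl[T-x] {y} y∈T with y ≟ᶠ x
    ... | yes refl = cl-least (cl-RuleClosed (T - x)) (λ a → ⊆-cl (T - x) (A⊆T-x a)) x∈clA
    ... | no y≢x   = ⊆-cl (T - x) (x∈p∧x≢y⇒x∈p-y y∈T y≢x)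

  cl-injective : ∀ {A B} → A ⊆ T → B ⊆ T → cl A ≡ cl B → A ≡ B
  cl-injective A⊆T B⊆T clA≡clB = ⊆-antisym
    (λ x∈A → cl-trace B⊆T (A⊆T x∈A) (subst (_ ∈ˢ_) clA≡clB (⊆-cl _ x∈A)))
    (λ x∈B → cl-trace A⊆T (B⊆T x∈B) (subst (_ ∈ˢ_) (sym clA≡clB) (⊆-cl _ x∈B)))

  2^∣T∣≤∣𝒞∣ : (𝒞 : List (Subset n)) → (∀ B → (B ∈ 𝒞 ⇔ Closed 𝒮 B)) → 2 ^ ∣ T ∣ ≤ length 𝒞
  2^∣T∣≤∣𝒞∣ 𝒞 enumerates = subst (_≤ length 𝒞) (length-subsets T)
    (injection⇒length≤ cl (subsets T) 𝒞 (subsets-unique T)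
      (λ A∈ B∈ → cl-injective (∈subsets⇒⊆ T A∈) (∈subsets⇒⊆ T B∈))
      (λ {A} _ → Equivalence.from (enumerates (cl A)) (cl-closed A)))

mainTheorem9 : ∀ {n} (𝒮 : Spanoid n) (𝒞 𝒪 : List (Subset n)) →
    Unique 𝒞 → (∀ B → (B ∈ 𝒞 ⇔ Closed 𝒮 B)) →
    Unique 𝒪 → (∀ B → (B ∈ 𝒪 ⇔ Open 𝒮 B)) →
    (∀ r → IsRank 𝒮 r → r ≤ ⌊log₂ length 𝒞 ⌋) × (length 𝒞 ≡ length 𝒪)
mainTheorem9 𝒮 𝒞 𝒪 u𝒞 h𝒞 u𝒪 h𝒪 = rank-bound , closed≡open
  where
  rank-bound : ∀ r → IsRank 𝒮 r → r ≤ ⌊log₂ length 𝒞 ⌋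
  rank-bound r ((T , spans , refl) , minimum) =
    subst (_≤ ⌊log₂ length 𝒞 ⌋) (⌊log₂[2^n]⌋≡n ∣ T ∣)
      (⌊log₂⌋-mono-≤ (MinimumSpanning.2^∣T∣≤∣𝒞∣ 𝒮 T spans minimum 𝒞 h𝒞))
  closed≡open : length 𝒞 ≡ length 𝒪
  closed≡open = involution⇒length≡ ∁ ∁-involutive 𝒞 𝒪 u𝒞 u𝒪
    (λ {B} B∈𝒞 → Equivalence.from (h𝒪 (∁ B))
       (subst (Closed 𝒮) (sym (∁-involutive B)) (Equivalence.to (h𝒞 B) B∈𝒞)))
    (λ {B} B∈𝒪 → Equivalence.from (h𝒞 (∁ B)) (Equivalence.to (h𝒪 B) B∈𝒪))
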